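{- There are infinitely many pairwise nonequivalent sets $\{a,b,c,d\}$ of four distinct nonzero integers such that $a,b,c,d$ are all perfect squares (so that $\{a,b,c,d\}$ is a $D(0)$-quadruple) and there exists an integer $n_2\neq 0$ such that $\{a,b,c,d\}$ is a $D(n_2)$-quadruple.
   Context: For an integer $n$ (here $n=0$ is allowed), a set $\{a_1,a_2,a_3,a_4\}$ of four distinct nonzero integers is called a $D(n)$-quadruple if $a_ia_j+n$ is a perfect square (square of an integer) for all $1\le i<j\le 4$. Two sets are called equivalent if one is obtained from the other by multiplying all elements by a common nonzero rational number $u$ (a $D(n)$-quadruple $\{a,b,c,d\}$ yields the $D(nu^2)$-quadruple $\{au,bu,cu,du\}$ when these are integers, and such quadruples are considered equivalent). -}

module Defs where

open import Data.Nat using (ℕ)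
open import Data.Integer as ℤ using (ℤ; +_)
open import Data.Rational as ℚ using (ℚ; 0ℚ)
open import Data.List using (List; []; _∷_; map)
open import Data.List.Relation.Unary.All using (All)
open import Data.List.Relation.Unary.Unique.Propositional using (Unique)
open import Data.List.Relation.Binary.Subset.Propositional using (_⊆_)
open import Data.Product using (Σ; ∃; _×_)
open import Relation.Binary.PropositionalEquality using (_≡_; _≢_)
open import Relation.Nullary using (¬_)

IsSquare : ℤ → Set
IsSquare z = ∃ λ (k : ℤ) → z ≡ k ℤ.* k

record Quad : Set where
  constructor quad
  field
    a b c d : ℤ

open Quad public

elems : Quad → List ℤ
elems q = a q ∷ b q ∷ c q ∷ d q ∷ []

DistinctNonzero : Quad → Set
DistinctNonzero q = Unique (elems q) × All (λ x → x ≢ + 0) (elems q)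

IsDQuad : ℤ → Quad → Set
IsDQuad n q =
  DistinctNonzero q ×
  IsSquare (a q ℤ.* b q ℤ.+ n) × IsSquare (a q ℤ.* c q ℤ.+ n) ×
  IsSquare (a q ℤ.* d q ℤ.+ n) × IsSquare (b q ℤ.* c q ℤ.+ n) ×
  IsSquare (b q ℤ.* d q ℤ.+ n) × IsSquare (c q ℤ.* d q ℤ.+ n)

toℚ : ℤ → ℚ
toℚ z = z ℚ./ 1

Equivalent : Quad → Quad → Set
Equivalent q q' = Σ ℚ λ u → u ≢ 0ℚ ×
  (map (λ x → u ℚ.* toℚ x) (elems q) ⊆ map toℚ (elems q')) ×
  (map toℚ (elems q') ⊆ map (λ x → u ℚ.* toℚ x) (elems q))

{-# OPTIONS --safe #-}
-- For s ≥ 5 take the Pythagorean triple p = 2(s+1), q = s(s+2), h = s² + 2s + 2 and the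
-- set of squares {(15p)², (48p)², (36q)², (20q)²}, with n₂ = (720pq)².  Both 15p·48p and
-- 36q·20q equal 720 times p² resp. q², so adding n₂ gives (720p)²h² resp. (720q)²h²; the
-- other four products together with 720pq are multiples of the triples (3,4,5), (5,12,13),
-- (12,5,13) and (4,3,5).  A rational scaling between two sets of positive integers sends
-- least element to least and greatest to greatest, so it preserves the ratio
-- (36q/15p)² of greatest to least element, and q/p = s(s+2)/(2(s+1)) is strictly increasing.
module Submission where

open import Defs
open import Data.Nat using (ℕ)
open import Data.Integer using (ℤ; +_)
open import Data.List.Relation.Unary.All using (All)
open import Data.Product using (Σ; _×_)
open import Relation.Binary.PropositionalEquality using (_≢_)
open import Relation.Nullary using (¬_)

open import Data.Nat using (suc; _+_; _*_; _≤_; _<_; z≤n; s≤s; >-nonZero; >-nonZero⁻¹)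
import Data.Nat.Properties as ℕP
open import Data.Nat.Tactic.RingSolver using (solve-∀)
import Data.Integer as ℤ
open import Data.Integer using (-[1+_])
import Data.Integer.Properties as ℤP
open import Data.Rational as ℚ using (ℚ; mkℚ; toℚᵘ; ↥_; ↧_)
open import Data.Rational.Properties using (toℚᵘ-homo-*; toℚᵘ-fromℚᵘ)
open import Data.Rational.Unnormalised as ℚᵘ using (mkℚᵘ; *≡*)
import Data.Rational.Unnormalised.Properties as ℚᵘP
open import Data.List using (List; []; _∷_; map)
open import Data.List.Relation.Unary.All using ([]; _∷_; lookup)
open import Data.List.Relation.Unary.AllPairs using ([]; _∷_)
open import Data.List.Relation.Unary.Any using (here; there)
open import Data.List.Membership.Propositional using (_∈_)
open import Data.List.Membership.Propositional.Properties using (∈-map⁺; ∈-map⁻)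
open import Data.List.Relation.Binary.Subset.Propositional using (_⊆_)
open import Data.Product using (_,_; ∃)
open import Relation.Binary.PropositionalEquality
  using (_≡_; refl; sym; trans; cong; cong₂; subst; subst₂; module ≡-Reasoning)
open import Relation.Binary.Definitions using (tri<; tri≈; tri>)
open import Relation.Nullary using (contradiction)

*-toℚ⇒cross : ∀ u x y → u ℚ.* toℚ x ≡ toℚ y → ↥ u ℤ.* x ≡ y ℤ.* ↧ u
*-toℚ⇒cross u@record{} x y eq = cross (begin
    toℚᵘ u ℚᵘ.* mkℚᵘ x 0      ≈⟨ ℚᵘP.*-congˡ {toℚᵘ u} (ℚᵘP.≃-sym (toℚᵘ-fromℚᵘ (mkℚᵘ x 0))) ⟩
    toℚᵘ u ℚᵘ.* toℚᵘ (toℚ x)  ≈⟨ ℚᵘP.≃-sym (toℚᵘ-homo-* u (toℚ x)) ⟩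
    toℚᵘ (u ℚ.* toℚ x)        ≡⟨ cong toℚᵘ eq ⟩
    toℚᵘ (toℚ y)              ≈⟨ toℚᵘ-fromℚᵘ (mkℚᵘ y 0) ⟩
    mkℚᵘ y 0                  ∎)
  where
  open ℚᵘP.≃-Reasoning
  cross : toℚᵘ u ℚᵘ.* mkℚᵘ x 0 ℚᵘ.≃ mkℚᵘ y 0 → ↥ u ℤ.* x ≡ y ℤ.* ↧ u
  cross (*≡* e) =
    trans (sym (ℤP.*-identityʳ _)) (trans e (cong (λ n → y ℤ.* + n) (ℕP.*-identityʳ _)))

InRange : ℕ → ℕ → ℤ → Set
InRange lo hi y = ∃ λ m → y ≡ + m × lo ≤ m × m ≤ hi

MinMax : ℕ → ℕ → Quad → Set
MinMax lo hi q = All (InRange lo hi) (elems q) × + lo ∈ elems q × + hi ∈ elems q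

module _ (u : ℚ) {lo hi : ℕ} {xs ys : List ℤ} where

  scaled-image : All (InRange lo hi) ys → map (λ x → u ℚ.* toℚ x) xs ⊆ map toℚ ys →
    ∀ {x} → x ∈ xs → ∃ λ m → lo ≤ m × m ≤ hi × ↥ u ℤ.* x ≡ + m ℤ.* ↧ u
  scaled-image rng sub {x} x∈ with ∈-map⁻ toℚ (sub (∈-map⁺ (λ x → u ℚ.* toℚ x) x∈))
  ... | y , y∈ , eq with lookup rng y∈
  ... | m , refl , lo≤m , m≤hi = m , lo≤m , m≤hi , *-toℚ⇒cross u x (+ m) eq

  scaled-preimage : All (InRange lo hi) xs → map toℚ ys ⊆ map (λ x → u ℚ.* toℚ x) xs →
    ∀ {y} → y ∈ ys → ∃ λ m → lo ≤ m × m ≤ hi × ↥ u ℤ.* + m ≡ y ℤ.* ↧ u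
  scaled-preimage rng sub {y} y∈ with ∈-map⁻ (λ x → u ℚ.* toℚ x) (sub (∈-map⁺ toℚ y∈))
  ... | x , x∈ , eq with lookup rng x∈
  ... | m , refl , lo≤m , m≤hi = m , lo≤m , m≤hi , *-toℚ⇒cross u (+ m) y (sym eq)

pos-*-injective : ∀ a b c d → + a ℤ.* + b ≡ + c ℤ.* + d → a * b ≡ c * d
pos-*-injective a b c d eq =
  ℤP.+-injective (trans (ℤP.pos-* a b) (trans eq (sym (ℤP.pos-* c d))))

module _ (n D : ℕ) {a b x y : ℕ} where
  open ℕP.≤-Reasoning

  min-scales : n * a ≡ y * D → b ≤ y → n * x ≡ b * D → a ≤ x → n * a ≡ b * D
  min-scales na≡yD b≤y nx≡bD a≤x = ℕP.≤-antisym
    (begin n * a ≤⟨ ℕP.*-monoʳ-≤ n a≤x ⟩ n * x ≡⟨ nx≡bD ⟩ b * D ∎)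
    (begin b * D ≤⟨ ℕP.*-monoˡ-≤ D b≤y ⟩ y * D ≡⟨ na≡yD ⟨ n * a ∎)

  max-scales : n * a ≡ y * D → y ≤ b → n * x ≡ b * D → x ≤ a → n * a ≡ b * D
  max-scales na≡yD y≤b nx≡bD x≤a = ℕP.≤-antisym
    (begin n * a ≡⟨ na≡yD ⟩ y * D ≤⟨ ℕP.*-monoˡ-≤ D y≤b ⟩ b * D ∎)
    (begin b * D ≡⟨ nx≡bD ⟨ n * x ≤⟨ ℕP.*-monoʳ-≤ n x≤a ⟩ n * a ∎)

cross-ratio : ∀ n d {lo hi lo' hi'} →
  n * lo ≡ lo' * suc d → n * hi ≡ hi' * suc d → lo * hi' ≡ hi * lo'
cross-ratio n d {lo} {hi} {lo'} {hi'} lo↦lo' hi↦hi' =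
  ℕP.*-cancelʳ-≡ (lo * hi') (hi * lo') (suc d) (begin
    lo * hi' * suc d    ≡⟨ ℕP.*-assoc lo hi' (suc d) ⟩
    lo * (hi' * suc d)  ≡⟨ cong (lo *_) hi↦hi' ⟨
    lo * (n * hi)       ≡⟨ swap lo n hi ⟩
    hi * (n * lo)       ≡⟨ cong (hi *_) lo↦lo' ⟩
    hi * (lo' * suc d)  ≡⟨ ℕP.*-assoc hi lo' (suc d) ⟨
    hi * lo' * suc d    ∎)
  where
  open ≡-Reasoning
  swap : ∀ x y z → x * (y * z) ≡ z * (y * x)
  swap = solve-∀

Equivalent⇒cross-ratio : ∀ {lo hi lo' hi' q q'} → 0 < lo →
  MinMax lo hi q → MinMax lo' hi' q' → Equivalent q q' → lo * hi' ≡ hi * lo'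
-- A negative numerator would send the positive lo to a negative number.
Equivalent⇒cross-ratio {suc _} _ (_ , lo∈ , _) (rng' , _) (u@(mkℚ -[1+ _ ] d _) , _ , sub , _)
  with scaled-image u rng' sub lo∈
... | m , _ , _ , eq = contradiction (trans eq (sym (ℤP.pos-* m (suc d)))) λ ()
Equivalent⇒cross-ratio {lo} {hi} {lo'} {hi'} _ (rng , lo∈ , hi∈) (rng' , lo'∈ , hi'∈)
  (u@(mkℚ (+ n) d _) , _ , sub , sup)
  with scaled-image u rng' sub lo∈ | scaled-image u rng' sub hi∈
     | scaled-preimage u rng sup lo'∈ | scaled-preimage u rng sup hi'∈
... | y₁ , lo'≤y₁ , _ , e₁ | y₂ , _ , y₂≤hi' , e₂ | x₁ , lo≤x₁ , _ , e₃ | x₂ , _ , x₂≤hi , e₄ =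
  cross-ratio n d
    (min-scales n D (pos-*-injective n lo y₁ D e₁) lo'≤y₁ (pos-*-injective n x₁ lo' D e₃) lo≤x₁)
    (max-scales n D (pos-*-injective n hi y₂ D e₂) y₂≤hi' (pos-*-injective n x₂ hi' D e₄) x₂≤hi)
  where D = suc d

square-quad : ℕ → ℕ → ℕ → ℕ → Quad
square-quad x y z w = quad (+ (x * x)) (+ (y * y)) (+ (z * z)) (+ (w * w))

PairwiseSquare : ℤ → Quad → Set
PairwiseSquare n q =
  IsSquare (a q ℤ.* b q ℤ.+ n) × IsSquare (a q ℤ.* c q ℤ.+ n) ×
  IsSquare (a q ℤ.* d q ℤ.+ n) × IsSquare (b q ℤ.* c q ℤ.+ n) ×
  IsSquare (b q ℤ.* d q ℤ.+ n) × IsSquare (c q ℤ.* d q ℤ.+ n)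

*-square : ∀ x y → (x * y) * (x * y) ≡ x * x * (y * y)
*-square = solve-∀

pos-square : ∀ x → IsSquare (+ (x * x))
pos-square x = + x , ℤP.pos-* x x

square-quad-squares : ∀ x y z w → All IsSquare (elems (square-quad x y z w))
square-quad-squares x y z w =
  pos-square x ∷ pos-square y ∷ pos-square z ∷ pos-square w ∷ []

squares-product-plus-square : ∀ x y n w → (x * y) * (x * y) + n * n ≡ w * w →
  IsSquare (+ (x * x) ℤ.* + (y * y) ℤ.+ + (n * n))
squares-product-plus-square x y n w eq = + w , (begin
  + (x * x) ℤ.* + (y * y) ℤ.+ + (n * n)  ≡⟨ cong (ℤ._+ + (n * n)) (ℤP.pos-* (x * x) (y * y)) ⟨
  + (x * x * (y * y)) ℤ.+ + (n * n)     ≡⟨ ℤP.pos-+ (x * x * (y * y)) (n * n) ⟨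
  + (x * x * (y * y) + n * n)           ≡⟨ cong (λ z → + (z + n * n)) (*-square x y) ⟨
  + ((x * y) * (x * y) + n * n)         ≡⟨ cong +_ eq ⟩
  + (w * w)                             ≡⟨ ℤP.pos-* w w ⟩
  + w ℤ.* + w                           ∎)
  where open ≡-Reasoning

square-quad-D0 : ∀ x y z w → PairwiseSquare (+ 0) (square-quad x y z w)
square-quad-D0 x y z w =
  product x y , product x z , product x w , product y z , product y w , product z w
  where
  product : ∀ m n → IsSquare (+ (m * m) ℤ.* + (n * n) ℤ.+ + 0)
  product m n = squares-product-plus-square m n 0 (m * n) (ℕP.+-identityʳ _)

scaled-triple : ∀ {u v w} → u * u + v * v ≡ w * w →
  ∀ k → (k * u) * (k * u) + (k * v) * (k * v) ≡ (k * w) * (k * w)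
scaled-triple {u} {v} {w} triple k = begin
  (k * u) * (k * u) + (k * v) * (k * v)  ≡⟨ cong₂ _+_ (*-square k u) (*-square k v) ⟩
  k * k * (u * u) + k * k * (v * v)      ≡⟨ ℕP.*-distribˡ-+ (k * k) (u * u) (v * v) ⟨
  k * k * (u * u + v * v)                ≡⟨ cong (k * k *_) triple ⟩
  k * k * (w * w)                        ≡⟨ *-square k w ⟨
  (k * w) * (k * w)                      ∎
  where open ≡-Reasoning

triple-product-plus-square : ∀ {u v w} → u * u + v * v ≡ w * w →
  ∀ x y n k → x * y ≡ k * u → n ≡ k * v → IsSquare (+ (x * x) ℤ.* + (y * y) ℤ.+ + (n * n))
triple-product-plus-square {u} {v} {w} triple x y n k xy≡ku n≡kv =
  squares-product-plus-square x y n (k * w)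
    (trans (cong₂ (λ s t → s * s + t * t) xy≡ku n≡kv) (scaled-triple triple k))

Ascending : ℕ → ℕ → ℕ → ℕ → Set
Ascending a b c d = a < b × b < d × d < c

<⇒+≢ : ∀ {m n} → m < n → + m ≢ + n
<⇒+≢ m<n eq = ℕP.<⇒≢ m<n (ℤP.+-injective eq)

0<⇒+≢0 : ∀ {m} → 0 < m → + m ≢ + 0
0<⇒+≢0 0<m eq = <⇒+≢ 0<m (sym eq)

ascending-distinct : ∀ {a b c d} → 0 < a → Ascending a b c d →
  DistinctNonzero (quad (+ a) (+ b) (+ c) (+ d))
ascending-distinct 0<a (a<b , b<d , d<c) =
  ((<⇒+≢ a<b ∷ <⇒+≢ a<c ∷ <⇒+≢ a<d ∷ []) ∷ (<⇒+≢ b<c ∷ <⇒+≢ b<d ∷ []) ∷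
   ((λ eq → <⇒+≢ d<c (sym eq)) ∷ []) ∷ [] ∷ []) ,
  (0<⇒+≢0 0<a ∷ 0<⇒+≢0 (ℕP.<-trans 0<a a<b) ∷ 0<⇒+≢0 (ℕP.<-trans 0<a a<c) ∷
   0<⇒+≢0 (ℕP.<-trans 0<a a<d) ∷ [])
  where
  a<d = ℕP.<-trans a<b b<d
  b<c = ℕP.<-trans b<d d<c
  a<c = ℕP.<-trans a<b b<c

ascending-minmax : ∀ {a b c d} → Ascending a b c d → MinMax a c (quad (+ a) (+ b) (+ c) (+ d))
ascending-minmax {a} {b} {c} {d} (a<b , b<d , d<c) =
  (in-range ℕP.≤-refl (ℕP.<⇒≤ a<c) ∷ in-range (ℕP.<⇒≤ a<b) (ℕP.<⇒≤ b<c) ∷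
   in-range (ℕP.<⇒≤ a<c) ℕP.≤-refl ∷ in-range (ℕP.<⇒≤ a<d) (ℕP.<⇒≤ d<c) ∷ []) ,
  here refl , there (there (here refl))
  where
  a<d = ℕP.<-trans a<b b<d
  b<c = ℕP.<-trans b<d d<c
  a<c = ℕP.<-trans a<b b<c
  in-range : ∀ {m} → a ≤ m → m ≤ c → InRange a c (+ m)
  in-range a≤m m≤c = _ , refl , a≤m , m≤c

square-< : ∀ {m n} → m < n → m * m < n * n
square-< m<n = ℕP.*-mono-< m<n m<n

squares-ascending : ∀ {x y z w} → Ascending x y z w → Ascending (x * x) (y * y) (z * z) (w * w)
squares-ascending (x<y , y<w , w<z) = square-< x<y , square-< y<w , square-< w<z

pythagorean-quad : ℕ → ℕ → Quad
pythagorean-quad p q = square-quad (15 * p) (48 * p) (36 * q) (20 * q)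

leg-pair-square : ∀ {u v w} → u * u + v * v ≡ w * w → ∀ α β n → α * β ≡ 720 → n ≡ 720 * u * v →
  IsSquare (+ ((α * u) * (α * u)) ℤ.* + ((β * u) * (β * u)) ℤ.+ + (n * n))
leg-pair-square {u} {v} {w} triple α β n αβ≡720 n≡ =
  triple-product-plus-square {u} {v} {w} triple (α * u) (β * u) n (720 * u)
    (trans (rearrange α β u) (cong (λ m → m * u * u) αβ≡720)) n≡
  where
  rearrange : ∀ α β u → α * u * (β * u) ≡ α * β * u * u
  rearrange = solve-∀

cross-pair-square : ∀ {u v w} → u * u + v * v ≡ w * w → ∀ α β c → α * β ≡ c * u → 720 ≡ c * v →
  ∀ p q → IsSquare (+ ((α * p) * (α * p)) ℤ.* + ((β * q) * (β * q)) ℤ.+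
                    + ((720 * p * q) * (720 * p * q)))
cross-pair-square {u} {v} {w} triple α β c αβ≡cu 720≡cv p q =
  triple-product-plus-square {u} {v} {w} triple (α * p) (β * q) (720 * p * q) (c * p * q)
    (trans (rearrange α β p q) (trans (cong (_* (p * q)) αβ≡cu) (rearrange′ c u p q)))
    (trans (cong (λ m → m * p * q) 720≡cv) (rearrange″ c v p q))
  where
  rearrange : ∀ α β p q → α * p * (β * q) ≡ α * β * (p * q)
  rearrange = solve-∀
  rearrange′ : ∀ c u p q → c * u * (p * q) ≡ c * p * q * u
  rearrange′ = solve-∀
  rearrange″ : ∀ c v p q → c * v * p * q ≡ c * p * q * v
  rearrange″ = solve-∀

pythagorean-quad-shifted : ∀ {p q h} → p * p + q * q ≡ h * h →
  PairwiseSquare (+ ((720 * p * q) * (720 * p * q))) (pythagorean-quad p q)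
pythagorean-quad-shifted {p} {q} {h} triple =
  leg-pair-square {p} {q} {h} triple 15 48 (720 * p * q) refl refl ,
  cross-pair-square {3} {4} {5} refl 15 36 180 refl refl p q ,
  cross-pair-square {5} {12} {13} refl 15 20 60 refl refl p q ,
  cross-pair-square {12} {5} {13} refl 48 36 144 refl refl p q ,
  cross-pair-square {4} {3} {5} refl 48 20 240 refl refl p q ,
  leg-pair-square {q} {p} {h} (trans (ℕP.+-comm (q * q) (p * p)) triple)
    36 20 (720 * p * q) refl (swap 720 p q)
  where
  swap : ∀ k p q → k * p * q ≡ k * q * p
  swap = solve-∀

module _ {p q : ℕ} (0<p : 0 < p) (separated : 48 * p < 20 * q) where

  0<q : 0 < q
  0<q = >-nonZero⁻¹ q {{ℕP.m*n≢0⇒n≢0 20 {{>-nonZero (ℕP.≤-<-trans z≤n separated)}}}}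

  legs-ascending : Ascending (15 * p) (48 * p) (36 * q) (20 * q)
  legs-ascending =
    ℕP.*-monoˡ-< p {{>-nonZero 0<p}} (ℕP.m≤m+n 16 32) ,
    separated ,
    ℕP.*-monoˡ-< q {{>-nonZero 0<q}} (ℕP.m≤m+n 21 15)

  pythagorean-quad-distinct : DistinctNonzero (pythagorean-quad p q)
  pythagorean-quad-distinct =
    ascending-distinct (square-< (ℕP.*-monoʳ-< 15 0<p)) (squares-ascending legs-ascending)

  pythagorean-quad-minmax : MinMax ((15 * p) * (15 * p)) ((36 * q) * (36 * q)) (pythagorean-quad p q)
  pythagorean-quad-minmax = ascending-minmax (squares-ascending legs-ascending)

  pythagorean-shift-nonzero : + ((720 * p * q) * (720 * p * q)) ≢ + 0
  pythagorean-shift-nonzero =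
    0<⇒+≢0 (square-< (ℕP.*-mono-< {0} {720 * p} (ℕP.*-mono-< {0} {720} (s≤s z≤n) 0<p) 0<q))

squared-ratio-< : ∀ {p q p' q'} → q * p' < q' * p →
  (36 * q * (36 * q)) * (15 * p' * (15 * p')) < (36 * q' * (36 * q')) * (15 * p * (15 * p))
squared-ratio-< {p} {q} {p'} {q'} lt =
  subst₂ _<_ (sym (rearrange q p')) (sym (rearrange q' p)) (square-< (ℕP.*-monoʳ-< 540 lt))
  where
  rearrange : ∀ a b → 36 * a * (36 * a) * (15 * b * (15 * b)) ≡ 540 * (a * b) * (540 * (a * b))
  rearrange = solve-∀

leg₁ leg₂ hypotenuse : ℕ → ℕ
leg₁ s = 2 * (s + 1)
leg₂ s = s * (s + 2)
hypotenuse s = s * s + 2 * s + 2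

pythagorean : ∀ s → leg₁ s * leg₁ s + leg₂ s * leg₂ s ≡ hypotenuse s * hypotenuse s
pythagorean = identity
  where
  identity : ∀ s → 2 * (s + 1) * (2 * (s + 1)) + s * (s + 2) * (s * (s + 2)) ≡
    (s * s + 2 * s + 2) * (s * s + 2 * s + 2)
  identity = solve-∀

<-by-gap : ∀ {m n} k → n ≡ m + suc k → m < n
<-by-gap k refl = ℕP.m<m+n _ (s≤s z≤n)

leg₁-positive : ∀ s → 0 < leg₁ s
leg₁-positive s = <-by-gap (2 * s + 1) (gap s)
  where
  gap : ∀ s → 2 * (s + 1) ≡ 0 + (1 + (2 * s + 1))
  gap = solve-∀

legs-separated : ∀ i → 48 * leg₁ (i + 5) < 20 * leg₂ (i + 5)
legs-separated i = <-by-gap (20 * i * i + 144 * i + 123) (gap i)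
  where
  gap : ∀ i → 20 * ((i + 5) * (i + 5 + 2)) ≡
    48 * (2 * (i + 5 + 1)) + (1 + (20 * i * i + 144 * i + 123))
  gap = solve-∀

leg-ratio-increasing : ∀ {s s'} → s < s' → leg₂ s * leg₁ s' < leg₂ s' * leg₁ s
leg-ratio-increasing {s} {s'} s<s' with ℕP.m≤n⇒∃[o]m+o≡n s<s'
... | o , 1+s+o≡s' =
  subst (λ t → leg₂ s * leg₁ t < leg₂ t * leg₁ s) (trans (cong (_+ o) (ℕP.+-comm s 1)) 1+s+o≡s')
    (<-by-gap (2 * (t * r * o + t * r + t * o + r) + 1) (gap s o))
  where
  t = s + 1
  r = s + 1 + o
  gap : ∀ s o → (s + 1 + o) * (s + 1 + o + 2) * (2 * (s + 1)) ≡
    s * (s + 2) * (2 * (s + 1 + o + 1)) +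
    (1 + (2 * ((s + 1) * (s + 1 + o) * o + (s + 1) * (s + 1 + o) + (s + 1) * o + (s + 1 + o)) + 1))
  gap = solve-∀

family : ℕ → Quad
family i = pythagorean-quad (leg₁ (i + 5)) (leg₂ (i + 5))

family-min family-max : ℕ → ℕ
family-min i = 15 * leg₁ (i + 5) * (15 * leg₁ (i + 5))
family-max i = 36 * leg₂ (i + 5) * (36 * leg₂ (i + 5))

family-ratio-increasing : ∀ {i j} → i < j → family-max i * family-min j < family-max j * family-min i
family-ratio-increasing {i} {j} i<j =
  squared-ratio-< {leg₁ (i + 5)} {leg₂ (i + 5)} {leg₁ (j + 5)} {leg₂ (j + 5)}
    (leg-ratio-increasing (ℕP.+-monoˡ-< 5 i<j))

family-ratio-injective : ∀ {i j} → i ≢ j → family-min i * family-max j ≢ family-max i * family-min j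
family-ratio-injective {i} {j} i≢j cross with ℕP.<-cmp i j
... | tri< i<j _ _ =
  ℕP.<⇒≢ (family-ratio-increasing i<j) (trans (sym cross) (ℕP.*-comm (family-min i) (family-max j)))
... | tri≈ _ i≡j _ = i≢j i≡j
... | tri> _ _ j<i =
  ℕP.<⇒≢ (family-ratio-increasing j<i) (trans (ℕP.*-comm (family-max j) (family-min i)) cross)

family-min-positive : ∀ i → 0 < family-min i
family-min-positive i = square-< {0} (ℕP.*-monoʳ-< 15 (leg₁-positive (i + 5)))

family-minmax : ∀ i → MinMax (family-min i) (family-max i) (family i)
family-minmax i =
  pythagorean-quad-minmax {leg₁ (i + 5)} {leg₂ (i + 5)} (leg₁-positive (i + 5)) (legs-separated i)

family-nonequivalent : ∀ i j → i ≢ j → ¬ Equivalent (family i) (family j)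
family-nonequivalent i j i≢j equiv = family-ratio-injective i≢j
  (Equivalent⇒cross-ratio (family-min-positive i) (family-minmax i) (family-minmax j) equiv)

proposition2 : Σ (ℕ → Quad) λ f →
    ((i : ℕ) → All IsSquare (elems (f i)) × IsDQuad (+ 0) (f i) ×
      Σ ℤ (λ n₂ → n₂ ≢ + 0 × IsDQuad n₂ (f i))) ×
    ((i j : ℕ) → i ≢ j → ¬ Equivalent (f i) (f j))
proposition2 = family , properties , family-nonequivalent
  where
  properties : ∀ i → All IsSquare (elems (family i)) × IsDQuad (+ 0) (family i) ×
    Σ ℤ (λ n₂ → n₂ ≢ + 0 × IsDQuad n₂ (family i))
  properties i =
    square-quad-squares (15 * p) (48 * p) (36 * q) (20 * q) ,
    (distinct , square-quad-D0 (15 * p) (48 * p) (36 * q) (20 * q)) ,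
    + ((720 * p * q) * (720 * p * q)) , pythagorean-shift-nonzero {p} {q} 0<p separated ,
    (distinct , pythagorean-quad-shifted {p} {q} {hypotenuse (i + 5)} (pythagorean (i + 5)))
    where
    p = leg₁ (i + 5)
    q = leg₂ (i + 5)
    0<p = leg₁-positive (i + 5)
    separated = legs-separated i
    distinct = pythagorean-quad-distinct {p} {q} 0<p separated
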